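{- (1) If $\mathbb{D}$ is a degree $2$ lattice and $\mathbb{A}\subseteq\mathbb{D}$ is a sublattice, then $\mathbb{A}$ is a degree $2$ lattice. (2) If $\mathbb{D}'$ is a directed set which order-embeds into a degree $2$ lattice $\mathbb{D}$, then $\mathbb{D}'$ embeds cofinally into a degree $2$ sublattice of $\mathbb{D}$.
   Context: A lattice is a partial order $(D,\le_D)$ in which any two elements $x,y$ have a least upper bound $x\vee y$ and a greatest lower bound $x\wedge y$; a sublattice is a subset closed under $\vee$ and $\wedge$, with the induced order. A (semi-)lattice $D$ has degree $2$ if for every $d\in D$ and all $x_1,x_2,x_3<_D d$ there are $1\le i\ne j\le 3$ and $e<_D d$ with $x_i,x_j\le_D e$. A poset $\mathbb{P}$ embeds cofinally into $\mathbb{Q}$ if there is an order preserving injection $\mathbb{P}\to\mathbb{Q}$ whose range is cofinal in $\mathbb{Q}$. -}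

module Defs where

open import Level using (Level; _⊔_)
open import Data.Product using (Σ; ∃; _×_; _,_; proj₁; proj₂)
open import Data.Sum using (_⊎_)
open import Relation.Nullary using (¬_)
open import Relation.Unary using (Pred; _∈_)
open import Relation.Binary.Bundles using (Poset)
open import Relation.Binary.Lattice.Bundles using (Lattice)
open import Relation.Binary.Lattice.Structures using (IsLattice)
import Relation.Binary.Construct.On as On

private variable c ℓ₁ ℓ₂ c' ℓ₁' ℓ₂' ℓ : Level

-- Degree 2 for a lattice, with strict order  x < d  :=  x ≤ d and x ≉ d.
-- "there are i ≠ j in {1,2,3}" is spelled out as the three unordered pairs.
module _ (L : Lattice c ℓ₁ ℓ₂) where
  open Lattice L

  _<L_ : Carrier → Carrier → Set (ℓ₁ ⊔ ℓ₂)
  x <L y = x ≤ y × ¬ (x ≈ y)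

  Degree2 : Set (c ⊔ ℓ₁ ⊔ ℓ₂)
  Degree2 = ∀ d x₁ x₂ x₃ → x₁ <L d → x₂ <L d → x₃ <L d →
    ∃ λ e → e <L d ×
      ((x₁ ≤ e × x₂ ≤ e) ⊎ (x₁ ≤ e × x₃ ≤ e) ⊎ (x₂ ≤ e × x₃ ≤ e))

  IsSublattice : Pred Carrier ℓ → Set (c ⊔ ℓ)
  IsSublattice A = (∀ {x y} → x ∈ A → y ∈ A → (x ∨ y) ∈ A)
                 × (∀ {x y} → x ∈ A → y ∈ A → (x ∧ y) ∈ A)

  subLattice : (A : Pred Carrier ℓ) → IsSublattice A → Lattice (c ⊔ ℓ) ℓ₁ ℓ₂
  subLattice A (cl∨ , cl∧) = record
    { Carrier = Σ Carrier A
    ; _≈_ = λ x y → proj₁ x ≈ proj₁ y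
    ; _≤_ = λ x y → proj₁ x ≤ proj₁ y
    ; _∨_ = λ x y → (proj₁ x ∨ proj₁ y) , cl∨ (proj₂ x) (proj₂ y)
    ; _∧_ = λ x y → (proj₁ x ∧ proj₁ y) , cl∧ (proj₂ x) (proj₂ y)
    ; isLattice = record
      { isPartialOrder = On.isPartialOrder proj₁ isPartialOrder
      ; supremum = λ x y → let (p , q , r) = supremum (proj₁ x) (proj₁ y)
                           in p , q , λ z → r (proj₁ z)
      ; infimum = λ x y → let (p , q , r) = infimum (proj₁ x) (proj₁ y)
                          in p , q , λ z → r (proj₁ z)
      }
    }

Directed : Poset c' ℓ₁' ℓ₂' → Set (c' ⊔ ℓ₂')
Directed P = Carrier × (∀ x y → ∃ λ z → x ≤ z × y ≤ z)
  where open Poset P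

IsOrderEmbedding : (P : Poset c' ℓ₁' ℓ₂') (L : Lattice c ℓ₁ ℓ₂) →
                   (Poset.Carrier P → Lattice.Carrier L) → Set (c' ⊔ ℓ₂' ⊔ ℓ₂)
IsOrderEmbedding P L f = ∀ x y → (x P.≤ y → f x L.≤ f y) × (f x L.≤ f y → x P.≤ y)
  where module P = Poset P
        module L = Lattice L

IsCofinalEmbedding : (P : Poset c' ℓ₁' ℓ₂') (L : Lattice c ℓ₁ ℓ₂) →
                     (Poset.Carrier P → Lattice.Carrier L) → Set (c ⊔ c' ⊔ ℓ₁ ⊔ ℓ₁' ⊔ ℓ₂' ⊔ ℓ₂)
IsCofinalEmbedding P L g =
    (∀ x y → x P.≤ y → g x L.≤ g y)
  × (∀ x y → g x L.≈ g y → x P.≈ y)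
  × (∀ a → ∃ λ x → a L.≤ g x)
  where module P = Poset P
        module L = Lattice L

-- In a sublattice the witness e of degree 2 can be replaced by the join of the
-- two elements it bounds, which lies in the sublattice and is still strictly
-- below d.  For the second part take the down-closure of the image of D': it is
-- closed under meets because it is down-closed, and under joins because D' is
-- directed; it is degree 2 by the first part, and the image is cofinal in it.
module Submission where

open import Defs
open import Level using (Level; _⊔_; Lift; lift)
open import Data.Product using (Σ; ∃; _×_; _,_; proj₁; proj₂)
open import Data.Sum using (inj₁; inj₂)
open import Relation.Unary using (Pred; _∈_)
open import Relation.Binary.Bundles using (Poset)
open import Relation.Binary.Lattice.Bundles using (Lattice)

module _ {c ℓ₁ ℓ₂ : Level} (D : Lattice c ℓ₁ ℓ₂) where
  open Lattice D

  ≤-<L-trans : ∀ {x y z} → x ≤ y → _<L_ D y z → _<L_ D x z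
  ≤-<L-trans x≤y (y≤z , y≉z) =
    trans x≤y y≤z , λ x≈z → y≉z (antisym y≤z (trans (reflexive (Eq.sym x≈z)) x≤y))

  ∨-<L : ∀ {x y e d} → x ≤ e → y ≤ e → _<L_ D e d → _<L_ D (x ∨ y) d
  ∨-<L x≤e y≤e = ≤-<L-trans (∨-least x≤e y≤e)

  module _ {ℓ : Level} (A : Pred Carrier ℓ) (sub : IsSublattice D A) where
    private
      S = subLattice D A sub
      _⊔ˢ_ = Lattice._∨_ S

    join-below : ∀ (x y d : Σ Carrier A) {e} → proj₁ x ≤ e → proj₁ y ≤ e →
                 _<L_ D e (proj₁ d) →
                 ∃ λ j → _<L_ S j d × proj₁ x ≤ proj₁ j × proj₁ y ≤ proj₁ j
    join-below x y _ x≤e y≤e e<d = x ⊔ˢ y , ∨-<L x≤e y≤e e<d , x≤x∨y _ _ , y≤x∨y _ _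

    degree2-sublattice : Degree2 D → Degree2 S
    degree2-sublattice deg d x₁ x₂ x₃ x₁<d x₂<d x₃<d
      with deg (proj₁ d) (proj₁ x₁) (proj₁ x₂) (proj₁ x₃) x₁<d x₂<d x₃<d
    ... | e , e<d , inj₁ (x₁≤e , x₂≤e) =
      let (j , j<d , x₁≤j , x₂≤j) = join-below x₁ x₂ d x₁≤e x₂≤e e<d
      in j , j<d , inj₁ (x₁≤j , x₂≤j)
    ... | e , e<d , inj₂ (inj₁ (x₁≤e , x₃≤e)) =
      let (j , j<d , x₁≤j , x₃≤j) = join-below x₁ x₃ d x₁≤e x₃≤e e<d
      in j , j<d , inj₂ (inj₁ (x₁≤j , x₃≤j))
    ... | e , e<d , inj₂ (inj₂ (x₂≤e , x₃≤e)) =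
      let (j , j<d , x₂≤j , x₃≤j) = join-below x₂ x₃ d x₂≤e x₃≤e e<d
      in j , j<d , inj₂ (inj₂ (x₂≤j , x₃≤j))

module _ {c ℓ₁ ℓ₂ c' ℓ₁' ℓ₂' : Level} (D : Lattice c ℓ₁ ℓ₂) (D' : Poset c' ℓ₁' ℓ₂')
         (f : Poset.Carrier D' → Lattice.Carrier D) (emb : IsOrderEmbedding D' D f) where
  open Lattice D
  private module Q = Poset D'

  -- Lifted to the level demanded by the statement.
  DownClosure : Pred Carrier (c ⊔ ℓ₁ ⊔ ℓ₂ ⊔ c' ⊔ ℓ₁' ⊔ ℓ₂')
  DownClosure a = Lift (c ⊔ ℓ₁ ⊔ ℓ₂ ⊔ c' ⊔ ℓ₁' ⊔ ℓ₂') (∃ λ x → a ≤ f x)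

  DownClosure-isSublattice : Directed D' → IsSublattice D DownClosure
  DownClosure-isSublattice (_ , upper) = closed-∨ , closed-∧
    where
    closed-∨ : ∀ {a b} → a ∈ DownClosure → b ∈ DownClosure → (a ∨ b) ∈ DownClosure
    closed-∨ (lift (x , a≤fx)) (lift (y , b≤fy)) =
      let (z , x≤z , y≤z) = upper x y
      in lift (z , ∨-least (trans a≤fx (proj₁ (emb x z) x≤z))
                           (trans b≤fy (proj₁ (emb y z) y≤z)))

    closed-∧ : ∀ {a b} → a ∈ DownClosure → b ∈ DownClosure → (a ∧ b) ∈ DownClosure
    closed-∧ (lift (x , a≤fx)) _ = lift (x , trans (x∧y≤x _ _) a≤fx)

  cofinal-in-DownClosure : (dir : Directed D') →
    ∃ λ g → IsCofinalEmbedding D' (subLattice D DownClosure (DownClosure-isSublattice dir)) g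
  cofinal-in-DownClosure _ =
      (λ x → f x , lift (x , refl))
    , (λ x y → proj₁ (emb x y))
    , (λ x y fx≈fy → Q.antisym (proj₂ (emb x y) (reflexive fx≈fy))
                               (proj₂ (emb y x) (reflexive (Eq.sym fx≈fy))))
    , λ { (_ , lift below) → below }

proposition2p7 : ∀ {c ℓ₁ ℓ₂ ℓ c' ℓ₁' ℓ₂' : Level} →
    ((D : Lattice c ℓ₁ ℓ₂) → Degree2 D →
      (A : Pred (Lattice.Carrier D) ℓ) → (sub : IsSublattice D A) →
      Degree2 (subLattice D A sub))
    ×
    ((D : Lattice c ℓ₁ ℓ₂) → Degree2 D →
      (D' : Poset c' ℓ₁' ℓ₂') → Directed D' →
      (f : Poset.Carrier D' → Lattice.Carrier D) → IsOrderEmbedding D' D f →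
      Σ (Pred (Lattice.Carrier D) (c ⊔ ℓ₁ ⊔ ℓ₂ ⊔ c' ⊔ ℓ₁' ⊔ ℓ₂')) λ A →
      Σ (IsSublattice D A) λ sub →
        Degree2 (subLattice D A sub) ×
        ∃ λ g → IsCofinalEmbedding D' (subLattice D A sub) g)
proposition2p7 =
    (λ D deg A sub → degree2-sublattice D A sub deg)
  , λ D deg D' dir f emb →
      let sub = DownClosure-isSublattice D D' f emb dir
      in DownClosure D D' f emb , sub
       , degree2-sublattice D (DownClosure D D' f emb) sub deg
       , cofinal-in-DownClosure D D' f emb dir
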